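{- Let $n\geq 1$, let $H$ be a finite simple graph, and let $G=E_n+H$. Let $\mathcal{R}=\{\{u,v\} : u\in V(E_n), v\in V(H)\}$. Let $\mathcal{I}$ be an independent set of $F_2(G)$ with $\mathcal{I}\cap\mathcal{R}\neq\emptyset$. Then there exist an independent set $S_1$ of $E_n$ and an independent set $S_2$ of $H$ such that the independent set $\mathcal{I}_{S_1,S_2}$ of $F_2(G)$ associated with $S_1$ and $S_2$ satisfies $|\mathcal{I}_{S_1,S_2}|\geq|\mathcal{I}|$; equivalently, $$|S_1|\,|S_2|+\alpha\big(F_2(E_n-S_1)\big)+\alpha\big(F_2(H-S_2)\big)\geq |\mathcal{I}|.$$
   Context: For a finite simple graph $G$, the $2$-token graph $F_2(G)$ is the graph whose vertices are the $2$-element subsets of $V(G)$, two such subsets being adjacent iff their symmetric difference is an edge of $G$ (if $G$ has fewer than $2$ vertices, $F_2(G)$ is empty with independence number $0$). $\alpha$ denotes independence number. $E_n$ is the edgeless graph on $n$ vertices. The join $G_1+G_2$ of disjoint graphs has vertex set $V(G_1)\cup V(G_2)$ and edges $E(G_1)\cup E(G_2)\cup\{uv: u\in V(G_1),v\in V(G_2)\}$. For independent sets $I_1$ of $G_1$ and $I_2$ of $G_2$, let $\mathcal{I}_i$ be a maximum independent set of $F_2(G_i-I_i)$ ($i=1,2$); the set $\mathcal{I}_{I_1,I_2}=\{\{u,v\}: u\in I_1, v\in I_2\}\cup\mathcal{I}_1\cup\mathcal{I}_2$ is an independent set of $F_2(G_1+G_2)$, called an independent set associated with $I_1$ and $I_2$;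 its size is $|I_1||I_2|+\alpha(F_2(G_1-I_1))+\alpha(F_2(G_2-I_2))$. Here $G_1=E_n$, $G_2=H$. -}

module Defs where

open import Data.Bool using (Bool; true; false; not; _∧_; _∨_)
open import Data.Nat using (ℕ; _⊔_)
open import Data.Fin using (Fin)
open import Data.Fin.Properties as FinP using ()
open import Data.Fin.Subset using (Subset; _∈_)
open import Data.Vec using (_[_]=_; lookup)
open import Data.List using (List; []; _∷_; map; _++_; filter; length; foldr; allFin)
open import Data.Product using (_×_; _,_)
import Data.Product.Properties as ProdP
open import Data.Sum using (_⊎_; inj₁; inj₂)
import Data.Sum.Properties as SumP
open import Relation.Binary.PropositionalEquality using (_≡_)
open import Relation.Binary.Definitions using (DecidableEquality)
open import Relation.Nullary.Decidable using (⌊_⌋; does)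
open import Data.List.Relation.Binary.Sublist.Propositional using (_⊆_)

record SimpleGraph (m : ℕ) : Set where
  field
    adj    : Fin m → Fin m → Bool
    sym    : ∀ i j → adj i j ≡ adj j i
    irrefl : ∀ i → adj i i ≡ false
open SimpleGraph public

Empty : (n : ℕ) → SimpleGraph n
Empty n = record { adj = λ _ _ → false ; sym = λ _ _ → Relation.Binary.PropositionalEquality.refl
                 ; irrefl = λ _ → Relation.Binary.PropositionalEquality.refl }

IsIndependentSubset : ∀ {m} → SimpleGraph m → Subset m → Set
IsIndependentSubset G S = ∀ i j → i ∈ S → j ∈ S → adj G i j ≡ false

-- General finite graphs given by a carrier, an explicit duplicate-free
-- enumeration of the vertices and a Bool-valued adjacency.

record Graph : Set₁ where
  field
    V     : Set
    _≟V_  : DecidableEquality V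
    verts : List V
    E     : V → V → Bool
open Graph public

toGraph : ∀ {m} → SimpleGraph m → Graph
toGraph {m} G = record { V = Fin m ; _≟V_ = FinP._≟_ ; verts = allFin m ; E = adj G }

join : ∀ {n m} → SimpleGraph n → SimpleGraph m → Graph
join {n} {m} G₁ G₂ = record
  { V = Fin n ⊎ Fin m
  ; _≟V_ = SumP.≡-dec FinP._≟_ FinP._≟_
  ; verts = map inj₁ (allFin n) ++ map inj₂ (allFin m)
  ; E = e }
  where
  e : Fin n ⊎ Fin m → Fin n ⊎ Fin m → Bool
  e (inj₁ i) (inj₁ j) = adj G₁ i j
  e (inj₂ i) (inj₂ j) = adj G₂ i j
  e (inj₁ _) (inj₂ _) = true
  e (inj₂ _) (inj₁ _) = true

delete : ∀ {m} → SimpleGraph m → Subset m → Graph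
delete {m} G S = record
  { V = Fin m ; _≟V_ = FinP._≟_
  ; verts = filter (λ i → Relation.Nullary.Decidable.¬? (Data.Bool._≟_ (lookup S i) true)) (allFin m)
  ; E = adj G }

-- all 2-element subsets {x,y} of a duplicate-free list, each listed once
-- as the pair (x , y) with x occurring before y.
pairs : ∀ {A : Set} → List A → List (A × A)
pairs []       = []
pairs (x ∷ xs) = map (x ,_) xs ++ pairs xs

-- {a,b} ~ {c,d} iff their symmetric difference is an edge of G
-- (for 2-sets and irreflexive G this is: they share exactly one element
-- and the two remaining elements are adjacent).
tokenAdj : (G : Graph) → V G × V G → V G × V G → Bool
tokenAdj G (a , b) (c , d) =
     (eq a c ∧ E G b d) ∨ (eq a d ∧ E G b c)
  ∨ (eq b c ∧ E G a d) ∨ (eq b d ∧ E G a c)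
  where eq : V G → V G → Bool
        eq x y = does (_≟V_ G x y)

F₂ : Graph → Graph
F₂ G = record
  { V = V G × V G
  ; _≟V_ = ProdP.≡-dec (_≟V_ G) (_≟V_ G)
  ; verts = pairs (verts G)
  ; E = tokenAdj G }

allB : ∀ {A : Set} → (A → Bool) → List A → Bool
allB p []       = true
allB p (x ∷ xs) = p x ∧ allB p xs

independent? : (G : Graph) → List (V G) → Bool
independent? G L = allB (λ x → allB (λ y → not (E G x y)) L) L

-- An independent set of G: a sublist of the vertex enumeration
-- (hence a set of vertices) with no edges inside.
IsIndependent : (G : Graph) → List (V G) → Set
IsIndependent G L = (L ⊆ verts G) × (independent? G L ≡ true)

sublists : ∀ {A : Set} → List A → List (List A)
sublists []       = [] ∷ []
sublists (x ∷ xs) = map (x ∷_) (sublists xs) ++ sublists xs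

α : Graph → ℕ
α G = foldr _⊔_ 0 (map length (filter (λ L → Data.Bool._≟_ (independent? G L) true) (sublists (verts G))))

data Crossing {n m : ℕ} : (Fin n ⊎ Fin m) × (Fin n ⊎ Fin m) → Set where
  cross₁ : ∀ u v → Crossing (inj₁ u , inj₂ v)
  cross₂ : ∀ u v → Crossing (inj₂ v , inj₁ u)

{-# OPTIONS --safe #-}
module Submission where

-- Pick u ∈ V(Eₙ) lying in the most 2-sets {u, v} ∈ I with v ∈ V(H); let S₂ be the set of those v,
-- and S₁ the set of vertices of Eₙ lying in some 2-set of I ∩ ℛ. Two 2-sets {x, y}, {x, z} are
-- adjacent in F₂ as soon as y ~ z, and every vertex of Eₙ is adjacent to every vertex of H in the
-- join; so independence of I forces S₂ to be independent in H, the 2-sets of I inside Eₙ to avoid S₁,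
-- and those inside H to avoid S₂. Hence I splits into an independent set of F₂(Eₙ − S₁), one of
-- F₂(H − S₂), and at most Σ_{a ∈ S₁} deg a ≤ |S₁| · deg u = |S₁| |S₂| crossing 2-sets.

open import Defs hiding (sym)
open import Data.Nat using (ℕ; _≤_; _+_; _*_)
open import Data.Fin.Subset using (Subset; ∣_∣)
open import Data.List using (List; length)
open import Data.List.Relation.Unary.Any using (Any)
open import Data.Product using (_×_; Σ)

open import Data.Bool using (Bool; true; false; not; _∧_; _∨_)
import Data.Bool as Bool
open import Data.Bool.Properties using (∨-assoc; ∨-comm; ∧-conicalˡ; ∧-conicalʳ; not-injective)
import Data.Nat as ℕ
open import Data.Nat using (_⊔_; z≤n; s≤s)
open import Data.Nat.ListAction using (sum)
open import Data.Nat.Properties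
  using (≤-trans; m≤m⊔n; m≤n⊔m; +-mono-≤; +-suc; m≤n⇒m≤1+n; module ≤-Reasoning)
open import Data.Fin using (Fin; zero; suc; fromℕ<)
open import Data.Fin.Subset using (_∉_) renaming (_∈_ to _∈ₛ_)
open import Data.List using ([]; _∷_; map; _++_; filter; foldr; mapMaybe; cartesianProduct; allFin; tabulate)
open import Data.List.Properties
  using (mapMaybe-++; mapMaybe-map; mapMaybe-just; mapMaybe-nothing; map-mapMaybe; map-++; map-∘;
         filter-++; filter-all; filter-none; ++-identityʳ)
open import Data.List.Extrema.Nat using (argmax; f[xs]≤f[argmax])
open import Data.List.Membership.Propositional using (_∈_)
open import Data.List.Membership.Propositional.Properties
  using (∈-map⁺; ∈-++⁺ˡ; ∈-++⁺ʳ; ∈-filter⁺; ∈-allFin)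
import Data.List.Membership.DecPropositional as DecMembership
open import Data.List.Relation.Binary.Sublist.Propositional using (_⊆_; []; _∷_; _∷ʳ_)
open import Data.List.Relation.Binary.Sublist.Propositional.Properties using (filter⁺)
open import Data.List.Relation.Unary.Any using (here; there; any?; satisfied)
open import Data.List.Relation.Unary.All as All using (All; []; _∷_)
open import Data.List.Relation.Unary.All.Properties using (¬Any⇒All¬) renaming (map⁺ to All-map⁺)
open import Data.Maybe using (Maybe; just; nothing)
open import Data.Product using (_,_; proj₁; proj₂; ∃; uncurry; swap)
import Data.Product as Product
open import Data.Product.Properties using (≡-dec)
open import Data.Sum using (_⊎_; inj₁; inj₂)
import Data.Sum as Sum
import Data.Vec as Vec
open import Data.Vec.Properties using (lookup∘tabulate; []=⇒lookup; lookup⇒[]=)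
open import Function using (_∘_; id)
open import Relation.Binary.Definitions using (DecidableEquality)
open import Relation.Binary.PropositionalEquality
open import Relation.Nullary using (¬_; Dec; yes; no; does; contradiction)
open import Relation.Nullary.Decidable using (dec-true; ¬?; _×-dec_; _⊎-dec_)
open import Relation.Unary using (Decidable)

private variable
  A B C : Set

mapMaybe⁺ : (f : A → Maybe B) {xs ys : List A} → xs ⊆ ys → mapMaybe f xs ⊆ mapMaybe f ys
mapMaybe⁺ f [] = []
mapMaybe⁺ f (y ∷ʳ p) with f y
... | just b  = b ∷ʳ mapMaybe⁺ f p
... | nothing = mapMaybe⁺ f p
mapMaybe⁺ f (_∷_ {x = x} refl p) with f x
... | just b  = refl ∷ mapMaybe⁺ f p
... | nothing = mapMaybe⁺ f p

∈-mapMaybe⁻ : (f : A → Maybe B) (xs : List A) {y : B} →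
              y ∈ mapMaybe f xs → ∃ λ x → x ∈ xs × f x ≡ just y
∈-mapMaybe⁻ f (x ∷ xs) y∈ with f x in fx
∈-mapMaybe⁻ f (x ∷ xs) (here refl) | just _  = x , here refl , fx
∈-mapMaybe⁻ f (x ∷ xs) (there y∈)  | just _  = Product.map₂ (Product.map₁ there) (∈-mapMaybe⁻ f xs y∈)
∈-mapMaybe⁻ f (x ∷ xs) y∈          | nothing = Product.map₂ (Product.map₁ there) (∈-mapMaybe⁻ f xs y∈)

mapMaybe-just-∘ : (g : A → B) (xs : List A) → mapMaybe (just ∘ g) xs ≡ map g xs
mapMaybe-just-∘ g xs = trans (sym (map-mapMaybe g just xs)) (cong (map g) (mapMaybe-just xs))

sublists⁺ : {L xs : List A} → L ⊆ xs → L ∈ sublists xs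
sublists⁺ [] = here refl
sublists⁺ {xs = y ∷ ys} (.y ∷ʳ p) = ∈-++⁺ʳ (map (y ∷_) (sublists ys)) (sublists⁺ p)
sublists⁺ (refl ∷ p) = ∈-++⁺ˡ (∈-map⁺ _ (sublists⁺ p))

≤-foldr-⊔ : {k : ℕ} {ks : List ℕ} → k ∈ ks → k ≤ foldr _⊔_ 0 ks
≤-foldr-⊔ (here refl) = m≤m⊔n _ _
≤-foldr-⊔ {ks = k′ ∷ _} (there k∈) = ≤-trans (≤-foldr-⊔ k∈) (m≤n⊔m k′ _)

allB⁻ : (p : A → Bool) {xs : List A} → allB p xs ≡ true → All (λ x → p x ≡ true) xs
allB⁻ p {[]} _ = []
allB⁻ p {x ∷ xs} e = ∧-conicalˡ (p x) _ e ∷ allB⁻ p (∧-conicalʳ (p x) _ e)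

allB⁺ : (p : A → Bool) {xs : List A} → All (λ x → p x ≡ true) xs → allB p xs ≡ true
allB⁺ p [] = refl
allB⁺ p (px ∷ pxs) rewrite px = allB⁺ p pxs

pairs-map : (g : A → B) (xs : List A) → pairs (map g xs) ≡ map (Product.map g g) (pairs xs)
pairs-map g [] = refl
pairs-map g (x ∷ xs) = begin
  map (g x ,_) (map g xs) ++ pairs (map g xs)
    ≡⟨ cong₂ _++_ (trans (sym (map-∘ xs)) (map-∘ xs)) (pairs-map g xs) ⟩
  map (Product.map g g) (map (x ,_) xs) ++ map (Product.map g g) (pairs xs)
    ≡⟨ map-++ (Product.map g g) (map (x ,_) xs) (pairs xs) ⟨
  map (Product.map g g) (map (x ,_) xs ++ pairs xs) ∎
  where open ≡-Reasoning

Both : (A → Set) → A × A → Set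
Both P (a , b) = P a × P b

module _ {P : A → Set} (P? : Decidable P) where

  both? : Decidable (Both P)
  both? (a , b) = P? a ×-dec P? b

  filter-both-map : {x : A} → P x → (ys : List A) → filter both? (map (x ,_) ys) ≡ map (x ,_) (filter P? ys)
  filter-both-map px [] = refl
  filter-both-map {x} px (y ∷ ys) with P? x | P? y
  ... | yes _  | yes _ = cong ((x , y) ∷_) (filter-both-map px ys)
  ... | yes _  | no _  = filter-both-map px ys
  ... | no ¬px | _     = contradiction px ¬px

  pairs-filter : (xs : List A) → pairs (filter P? xs) ≡ filter both? (pairs xs)
  pairs-filter [] = refl
  pairs-filter (x ∷ xs) with P? x
  ... | yes px = begin
    map (x ,_) (filter P? xs) ++ pairs (filter P? xs)
      ≡⟨ cong₂ _++_ (sym (filter-both-map px xs)) (pairs-filter xs) ⟩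
    filter both? (map (x ,_) xs) ++ filter both? (pairs xs)
      ≡⟨ filter-++ both? (map (x ,_) xs) (pairs xs) ⟨
    filter both? (map (x ,_) xs ++ pairs xs) ∎
    where open ≡-Reasoning
  ... | no ¬px = begin
    pairs (filter P? xs)
      ≡⟨ pairs-filter xs ⟩
    filter both? (pairs xs)
      ≡⟨ cong (_++ filter both? (pairs xs))
              (filter-none both? (All-map⁺ (All.universal (λ _ → ¬px ∘ proj₁) xs))) ⟨
    filter both? (map (x ,_) xs) ++ filter both? (pairs xs)
      ≡⟨ filter-++ both? (map (x ,_) xs) (pairs xs) ⟨
    filter both? (map (x ,_) xs ++ pairs xs) ∎
    where open ≡-Reasoning

  sum-≤-support*bound : (f : A → ℕ) {M : ℕ} → (∀ x → f x ≤ M) → (∀ x → ¬ P x → f x ≡ 0) →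
                        (xs : List A) → sum (map f xs) ≤ length (filter P? xs) * M
  sum-≤-support*bound f bound outside [] = z≤n
  sum-≤-support*bound f bound outside (x ∷ xs) with P? x
  ... | yes _ = +-mono-≤ (bound x) (sum-≤-support*bound f bound outside xs)
  ... | no ¬px rewrite outside x ¬px = sum-≤-support*bound f bound outside xs

  ∣tabulate∣≡length-filter : ∀ {n} (g : Fin n → A) →
                             ∣ Vec.tabulate (does ∘ P? ∘ g) ∣ ≡ length (filter P? (tabulate g))
  ∣tabulate∣≡length-filter {ℕ.zero}  g = refl
  ∣tabulate∣≡length-filter {ℕ.suc n} g with P? (g zero)
  ... | yes _ = cong ℕ.suc (∣tabulate∣≡length-filter (g ∘ suc))
  ... | no _  = ∣tabulate∣≡length-filter (g ∘ suc)


∈-tabulate⁻ : ∀ {n} {P : Fin n → Set} (P? : Decidable P) {i : Fin n} →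
              i ∈ₛ Vec.tabulate (does ∘ P?) → P i
∈-tabulate⁻ P? {i} i∈ with P? i | trans (sym (lookup∘tabulate (does ∘ P?) i)) ([]=⇒lookup i∈)
... | yes p | _ = p
... | no _  | ()

module _ {R : A → B → Set} (R? : ∀ x → Decidable (R x)) where

  length-⊆-cartesianProduct : (xs : List A) (ys : List B) {K : List (A × B)} →
    K ⊆ cartesianProduct xs ys → All (uncurry R) K →
    length K ≤ sum (map (λ x → length (filter (R? x) ys)) xs)
  length-⊆-cartesianProduct [] ys [] _ = z≤n
  length-⊆-cartesianProduct (x ∷ xs) ys = row ys
    where
    row : (zs : List B) {K : List (A × B)} → K ⊆ map (x ,_) zs ++ cartesianProduct xs ys → All (uncurry R) K →
          length K ≤ length (filter (R? x) zs) + sum (map (λ x → length (filter (R? x) ys)) xs)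
    row [] K⊆ rs = length-⊆-cartesianProduct xs ys K⊆ rs
    row (z ∷ zs) (_ ∷ʳ K⊆) rs with R? x z
    ... | yes _ = m≤n⇒m≤1+n (row zs K⊆ rs)
    ... | no _  = row zs K⊆ rs
    row (z ∷ zs) (refl ∷ K⊆) (r ∷ rs) with R? x z
    ... | yes _ = s≤s (row zs K⊆ rs)
    ... | no ¬r = contradiction r ¬r

_∈ᵘ_ : A × A → List (A × A) → Set
p ∈ᵘ zs = p ∈ zs ⊎ swap p ∈ zs

∈ᵘ-swap : {p : A × A} {zs : List (A × A)} → p ∈ᵘ zs → swap p ∈ᵘ zs
∈ᵘ-swap = Sum.swap

∈ᵘ? : DecidableEquality A → (p : A × A) (zs : List (A × A)) → Dec (p ∈ᵘ zs)
∈ᵘ? _≟_ p zs = (p ∈? zs) ⊎-dec (swap p ∈? zs)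
  where open DecMembership (≡-dec _≟_ _≟_) using (_∈?_)

∨-swap-halves : (p q r s : Bool) → r ∨ s ∨ p ∨ q ≡ p ∨ q ∨ r ∨ s
∨-swap-halves p q r s = trans (sym (∨-assoc r s _)) (trans (∨-comm (r ∨ s) _) (∨-assoc p q _))

∨-swap-pairs : (p q r s : Bool) → q ∨ p ∨ s ∨ r ≡ p ∨ q ∨ r ∨ s
∨-swap-pairs p q r s =
  trans (sym (∨-assoc q p _)) (trans (cong₂ _∨_ (∨-comm q p) (∨-comm s r)) (∨-assoc p q _))

module _ (G : Graph) where

  independent?-elim : {L : List (V G)} → independent? G L ≡ true →
                      {x y : V G} → x ∈ L → y ∈ L → E G x y ≡ false
  independent?-elim e x∈ y∈ = not-injective (All.lookup (allB⁻ _ (All.lookup (allB⁻ _ e) x∈)) y∈)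

  independent?-intro : {L : List (V G)} → (∀ {x y} → x ∈ L → y ∈ L → E G x y ≡ false) →
                       independent? G L ≡ true
  independent?-intro h = allB⁺ _ (All.tabulate λ x∈ → allB⁺ _ (All.tabulate λ y∈ → cong not (h x∈ y∈)))

  length≤α : {L : List (V G)} → IsIndependent G L → length L ≤ α G
  length≤α (L⊆ , indep) = ≤-foldr-⊔ (∈-map⁺ length (∈-filter⁺ _ (sublists⁺ L⊆) indep))

module _ (G : Graph) where

  private
    _≐_ : V G → V G → Bool
    x ≐ y = does (_≟V_ G x y)

  tokenAdj-swapˡ : (p q : V G × V G) → tokenAdj G (swap p) q ≡ tokenAdj G p q
  tokenAdj-swapˡ (a , b) (c , d) =
    ∨-swap-halves (a ≐ c ∧ E G b d) (a ≐ d ∧ E G b c) (b ≐ c ∧ E G a d) (b ≐ d ∧ E G a c)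

  tokenAdj-swapʳ : (p q : V G × V G) → tokenAdj G p (swap q) ≡ tokenAdj G p q
  tokenAdj-swapʳ (a , b) (c , d) =
    ∨-swap-pairs (a ≐ c ∧ E G b d) (a ≐ d ∧ E G b c) (b ≐ c ∧ E G a d) (b ≐ d ∧ E G a c)

  tokenAdj-shared : {a b d : V G} → E G b d ≡ true → tokenAdj G (a , b) (a , d) ≡ true
  tokenAdj-shared {a} bd rewrite dec-true (_≟V_ G a a) refl | bd = refl

  tokenAdj-∈ᵘ : {zs : List (V G × V G)} → independent? (F₂ G) zs ≡ true →
                {p q : V G × V G} → p ∈ᵘ zs → q ∈ᵘ zs → tokenAdj G p q ≡ false
  tokenAdj-∈ᵘ indep (inj₁ p∈) (inj₁ q∈) = independent?-elim (F₂ G) indep p∈ q∈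
  tokenAdj-∈ᵘ indep {p} {q} (inj₂ p∈) (inj₁ q∈) =
    trans (sym (tokenAdj-swapˡ p q)) (independent?-elim (F₂ G) indep p∈ q∈)
  tokenAdj-∈ᵘ indep {p} {q} (inj₁ p∈) (inj₂ q∈) =
    trans (sym (tokenAdj-swapʳ p q)) (independent?-elim (F₂ G) indep p∈ q∈)
  tokenAdj-∈ᵘ indep {p} {q} (inj₂ p∈) (inj₂ q∈) =
    trans (sym (tokenAdj-swapˡ p q))
          (trans (sym (tokenAdj-swapʳ (swap p) q)) (independent?-elim (F₂ G) indep p∈ q∈))

  shared-endpoint-nonadjacent : {zs : List (V G × V G)} → independent? (F₂ G) zs ≡ true →
                                {a b d : V G} → (a , b) ∈ᵘ zs → (a , d) ∈ᵘ zs → E G b d ≡ false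
  shared-endpoint-nonadjacent indep {b = b} {d} ab∈ ad∈ with E G b d in bd
  ... | false = refl
  ... | true with () ← trans (sym (tokenAdj-shared bd)) (tokenAdj-∈ᵘ indep ab∈ ad∈)

module _ {A B : Set} where

  pairs-⊎ : List A → List B → List ((A ⊎ B) × (A ⊎ B))
  pairs-⊎ xs ys = pairs (map inj₁ xs ++ map inj₂ ys)

  inside₁ : (A ⊎ B) × (A ⊎ B) → Maybe (A × A)
  inside₁ (inj₁ a , inj₁ a′) = just (a , a′)
  inside₁ _                  = nothing

  -- Both orders are accepted, so that every pair is caught by exactly one of across, inside₁, inside₂.
  across : (A ⊎ B) × (A ⊎ B) → Maybe (A × B)
  across (inj₁ a , inj₂ b) = just (a , b)
  across (inj₂ b , inj₁ a) = just (a , b)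
  across _                 = nothing

  inside₂ : (A ⊎ B) × (A ⊎ B) → Maybe (B × B)
  inside₂ (inj₂ b , inj₂ b′) = just (b , b′)
  inside₂ _                  = nothing

  length-across+inside : (zs : List ((A ⊎ B) × (A ⊎ B))) →
    length zs ≡ length (mapMaybe across zs) + length (mapMaybe inside₁ zs) + length (mapMaybe inside₂ zs)
  length-across+inside [] = refl
  length-across+inside ((inj₁ _ , inj₂ _) ∷ zs) = cong ℕ.suc (length-across+inside zs)
  length-across+inside ((inj₂ _ , inj₁ _) ∷ zs) = cong ℕ.suc (length-across+inside zs)
  length-across+inside ((inj₁ _ , inj₁ _) ∷ zs) =
    trans (cong ℕ.suc (length-across+inside zs)) (cong (_+ length (mapMaybe inside₂ zs)) (sym (+-suc _ _)))
  length-across+inside ((inj₂ _ , inj₂ _) ∷ zs) =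
    trans (cong ℕ.suc (length-across+inside zs)) (sym (+-suc _ _))

  private
    mapMaybe-pairs-inj₁∷ : (f : (A ⊎ B) × (A ⊎ B) → Maybe C) (x : A) (xs : List A) (ys : List B) →
      mapMaybe f (pairs-⊎ (x ∷ xs) ys)
        ≡ (mapMaybe (λ a → f (inj₁ x , inj₁ a)) xs ++ mapMaybe (λ b → f (inj₁ x , inj₂ b)) ys)
          ++ mapMaybe f (pairs-⊎ xs ys)
    mapMaybe-pairs-inj₁∷ f x xs ys = begin
      mapMaybe f (map (inj₁ x ,_) zs ++ pairs zs)
        ≡⟨ mapMaybe-++ f (map (inj₁ x ,_) zs) (pairs zs) ⟩
      mapMaybe f (map (inj₁ x ,_) zs) ++ mapMaybe f (pairs zs)
        ≡⟨ cong (_++ mapMaybe f (pairs zs))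
                (trans (mapMaybe-map f (inj₁ x ,_) zs) (mapMaybe-⊎ (f ∘ (inj₁ x ,_)))) ⟩
      (mapMaybe (λ a → f (inj₁ x , inj₁ a)) xs ++ mapMaybe (λ b → f (inj₁ x , inj₂ b)) ys)
        ++ mapMaybe f (pairs zs) ∎
      where
      open ≡-Reasoning
      zs = map inj₁ xs ++ map inj₂ ys

      mapMaybe-⊎ : (g : A ⊎ B → Maybe C) → mapMaybe g zs ≡ mapMaybe (g ∘ inj₁) xs ++ mapMaybe (g ∘ inj₂) ys
      mapMaybe-⊎ g = trans (mapMaybe-++ g (map inj₁ xs) (map inj₂ ys))
                           (cong₂ _++_ (mapMaybe-map g inj₁ xs) (mapMaybe-map g inj₂ ys))

    mapMaybe-pairs-inj₂ : (f : (A ⊎ B) × (A ⊎ B) → Maybe C) (ys : List B) →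
      mapMaybe f (pairs (map inj₂ ys)) ≡ mapMaybe (f ∘ Product.map inj₂ inj₂) (pairs ys)
    mapMaybe-pairs-inj₂ f ys = trans (cong (mapMaybe f) (pairs-map inj₂ ys)) (mapMaybe-map f _ (pairs ys))

  mapMaybe-inside₁-pairs : (xs : List A) (ys : List B) → mapMaybe inside₁ (pairs-⊎ xs ys) ≡ pairs xs
  mapMaybe-inside₁-pairs [] ys = trans (mapMaybe-pairs-inj₂ inside₁ ys) (mapMaybe-nothing (pairs ys))
  mapMaybe-inside₁-pairs (x ∷ xs) ys = begin
    mapMaybe inside₁ (pairs-⊎ (x ∷ xs) ys)
      ≡⟨ mapMaybe-pairs-inj₁∷ inside₁ x xs ys ⟩
    (mapMaybe (just ∘ (x ,_)) xs ++ mapMaybe (λ _ → nothing) ys) ++ mapMaybe inside₁ (pairs-⊎ xs ys)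
      ≡⟨ cong₂ _++_ (cong₂ _++_ (mapMaybe-just-∘ (x ,_) xs) (mapMaybe-nothing ys))
                    (mapMaybe-inside₁-pairs xs ys) ⟩
    (map (x ,_) xs ++ []) ++ pairs xs
      ≡⟨ cong (_++ pairs xs) (++-identityʳ (map (x ,_) xs)) ⟩
    pairs (x ∷ xs) ∎
    where open ≡-Reasoning

  mapMaybe-across-pairs : (xs : List A) (ys : List B) →
    mapMaybe across (pairs-⊎ xs ys) ≡ cartesianProduct xs ys
  mapMaybe-across-pairs [] ys = trans (mapMaybe-pairs-inj₂ across ys) (mapMaybe-nothing (pairs ys))
  mapMaybe-across-pairs (x ∷ xs) ys = begin
    mapMaybe across (pairs-⊎ (x ∷ xs) ys)
      ≡⟨ mapMaybe-pairs-inj₁∷ across x xs ys ⟩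
    (mapMaybe (λ _ → nothing) xs ++ mapMaybe (just ∘ (x ,_)) ys) ++ mapMaybe across (pairs-⊎ xs ys)
      ≡⟨ cong₂ _++_ (cong₂ _++_ (mapMaybe-nothing xs) (mapMaybe-just-∘ (x ,_) ys))
                    (mapMaybe-across-pairs xs ys) ⟩
    cartesianProduct (x ∷ xs) ys ∎
    where open ≡-Reasoning

  mapMaybe-inside₂-pairs : (xs : List A) (ys : List B) → mapMaybe inside₂ (pairs-⊎ xs ys) ≡ pairs ys
  mapMaybe-inside₂-pairs [] ys = trans (mapMaybe-pairs-inj₂ inside₂ ys) (mapMaybe-just (pairs ys))
  mapMaybe-inside₂-pairs (x ∷ xs) ys = begin
    mapMaybe inside₂ (pairs-⊎ (x ∷ xs) ys)
      ≡⟨ mapMaybe-pairs-inj₁∷ inside₂ x xs ys ⟩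
    (mapMaybe (λ _ → nothing) xs ++ mapMaybe (λ _ → nothing) ys) ++ mapMaybe inside₂ (pairs-⊎ xs ys)
      ≡⟨ cong₂ _++_ (cong₂ _++_ (mapMaybe-nothing xs) (mapMaybe-nothing ys)) (mapMaybe-inside₂-pairs xs ys) ⟩
    pairs ys ∎
    where open ≡-Reasoning

  ∈-mapMaybe-inside₁⁻ : {zs : List ((A ⊎ B) × (A ⊎ B))} {a a′ : A} →
                        (a , a′) ∈ mapMaybe inside₁ zs → (inj₁ a , inj₁ a′) ∈ zs
  ∈-mapMaybe-inside₁⁻ {zs} p∈ with ∈-mapMaybe⁻ inside₁ zs p∈
  ... | (inj₁ _ , inj₁ _) , z∈ , refl = z∈

  ∈-mapMaybe-across⁻ : {zs : List ((A ⊎ B) × (A ⊎ B))} {a : A} {b : B} →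
                       (a , b) ∈ mapMaybe across zs → (inj₁ a , inj₂ b) ∈ᵘ zs
  ∈-mapMaybe-across⁻ {zs} p∈ with ∈-mapMaybe⁻ across zs p∈
  ... | (inj₁ _ , inj₂ _) , z∈ , refl = inj₁ z∈
  ... | (inj₂ _ , inj₁ _) , z∈ , refl = inj₂ z∈

  ∈-mapMaybe-inside₂⁻ : {zs : List ((A ⊎ B) × (A ⊎ B))} {b b′ : B} →
                        (b , b′) ∈ mapMaybe inside₂ zs → (inj₂ b , inj₂ b′) ∈ zs
  ∈-mapMaybe-inside₂⁻ {zs} p∈ with ∈-mapMaybe⁻ inside₂ zs p∈
  ... | (inj₂ _ , inj₂ _) , z∈ , refl = z∈

module _ {k : ℕ} (G : SimpleGraph k) (S : Subset k) where

  private
    outside? : Decidable (λ i → ¬ Vec.lookup S i ≡ true)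
    outside? i = ¬? (Vec.lookup S i Bool.≟ true)

  length≤α-delete : {L : List (Fin k × Fin k)} → L ⊆ pairs (allFin k) → All (Both (_∉ S)) L →
                    independent? (F₂ (delete G S)) L ≡ true → length L ≤ α (F₂ (delete G S))
  length≤α-delete {L} L⊆ avoid indep = length≤α (F₂ (delete G S)) (L⊆pairs-outside , indep)
    where
    ∉⇒lookup≢ : ∀ {i} → i ∉ S → ¬ Vec.lookup S i ≡ true
    ∉⇒lookup≢ {i} i∉ e = i∉ (lookup⇒[]= i S e)

    L⊆pairs-outside : L ⊆ pairs (filter outside? (allFin k))
    L⊆pairs-outside =
      subst₂ _⊆_ (filter-all (both? outside?) (All.map (Product.map ∉⇒lookup≢ ∉⇒lookup≢) avoid))
                 (sym (pairs-filter outside? (allFin k)))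
                 (filter⁺ (both? outside?) (both? outside?) (λ { refl p → p }) L⊆)

module _ {n m : ℕ} {G₁ : SimpleGraph n} {G₂ : SimpleGraph m} {zs : List (V (F₂ (join G₁ G₂)))}
         (zs-independent : IsIndependent (F₂ (join G₁ G₂)) zs) where

  private
    zs⊆ : zs ⊆ pairs-⊎ (allFin n) (allFin m)
    zs⊆ = proj₁ zs-independent

    nonadjacent : {p q : V (F₂ (join G₁ G₂))} → p ∈ zs → q ∈ zs → tokenAdj (join G₁ G₂) p q ≡ false
    nonadjacent = independent?-elim (F₂ (join G₁ G₂)) (proj₂ zs-independent)

  length-inside₁≤α : (S : Subset n) → (∀ {a a′} → (inj₁ a , inj₁ a′) ∈ zs → a ∉ S × a′ ∉ S) →
                     length (mapMaybe inside₁ zs) ≤ α (F₂ (delete G₁ S))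
  length-inside₁≤α S avoid = length≤α-delete G₁ S
    (subst (mapMaybe inside₁ zs ⊆_) (mapMaybe-inside₁-pairs (allFin n) (allFin m)) (mapMaybe⁺ inside₁ zs⊆))
    (All.tabulate (avoid ∘ ∈-mapMaybe-inside₁⁻))
    (independent?-intro (F₂ (delete G₁ S)) λ p∈ q∈ →
      nonadjacent (∈-mapMaybe-inside₁⁻ p∈) (∈-mapMaybe-inside₁⁻ q∈))

  length-inside₂≤α : (S : Subset m) → (∀ {b b′} → (inj₂ b , inj₂ b′) ∈ zs → b ∉ S × b′ ∉ S) →
                     length (mapMaybe inside₂ zs) ≤ α (F₂ (delete G₂ S))
  length-inside₂≤α S avoid = length≤α-delete G₂ S
    (subst (mapMaybe inside₂ zs ⊆_) (mapMaybe-inside₂-pairs (allFin n) (allFin m)) (mapMaybe⁺ inside₂ zs⊆))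
    (All.tabulate (avoid ∘ ∈-mapMaybe-inside₂⁻))
    (independent?-intro (F₂ (delete G₂ S)) λ p∈ q∈ →
      nonadjacent (∈-mapMaybe-inside₂⁻ p∈) (∈-mapMaybe-inside₂⁻ q∈))

module Witnesses {n m : ℕ} {H : SimpleGraph m} {I : List (V (F₂ (join (Empty n) H)))}
                 (I-independent : IsIndependent (F₂ (join (Empty n) H)) I) (u₀ : Fin n) where

  private
    G : Graph
    G = join (Empty n) H

  nonadjacent : {x y z : V G} → (x , y) ∈ᵘ I → (x , z) ∈ᵘ I → E G y z ≡ false
  nonadjacent = shared-endpoint-nonadjacent G (proj₂ I-independent)

  Paired : Fin n → Fin m → Set
  Paired a v = (inj₁ a , inj₂ v) ∈ᵘ I

  paired? : ∀ a → Decidable (Paired a)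
  paired? a v = ∈ᵘ? (_≟V_ G) (inj₁ a , inj₂ v) I

  partnered? : Decidable (λ a → Any (Paired a) (allFin m))
  partnered? a = any? (paired? a) (allFin m)

  degree : Fin n → ℕ
  degree a = length (filter (paired? a) (allFin m))

  u : Fin n
  u = argmax degree u₀ (allFin n)

  S₁ : Subset n
  S₁ = Vec.tabulate (does ∘ partnered?)

  S₂ : Subset m
  S₂ = Vec.tabulate (does ∘ paired? u)

  S₂-independent : IsIndependentSubset H S₂
  S₂-independent i j i∈ j∈ = nonadjacent (∈-tabulate⁻ (paired? u) i∈) (∈-tabulate⁻ (paired? u) j∈)

  inside₁-avoids-S₁ : ∀ {a a′} → (inj₁ a , inj₁ a′) ∈ I → a ∉ S₁ × a′ ∉ S₁
  inside₁-avoids-S₁ aa′∈ = avoids (inj₁ aa′∈) , avoids (inj₂ aa′∈)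
    where
    avoids : ∀ {a a′} → (inj₁ a , inj₁ a′) ∈ᵘ I → a ∉ S₁
    avoids aa′∈ a∈ with v , av∈ ← satisfied (∈-tabulate⁻ partnered? a∈)
                   with () ← nonadjacent av∈ aa′∈

  inside₂-avoids-S₂ : ∀ {v v′} → (inj₂ v , inj₂ v′) ∈ I → v ∉ S₂ × v′ ∉ S₂
  inside₂-avoids-S₂ vv′∈ = avoids (inj₁ vv′∈) , avoids (inj₂ vv′∈)
    where
    avoids : ∀ {v v′} → (inj₂ v , inj₂ v′) ∈ᵘ I → v ∉ S₂
    avoids vv′∈ v∈ with () ← nonadjacent (∈ᵘ-swap (∈-tabulate⁻ (paired? u) v∈)) vv′∈

  across-bound : length (mapMaybe across I) ≤ ∣ S₁ ∣ * ∣ S₂ ∣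
  across-bound = begin
    length (mapMaybe across I)
      ≤⟨ length-⊆-cartesianProduct paired? (allFin n) (allFin m) across⊆ (All.tabulate ∈-mapMaybe-across⁻) ⟩
    sum (map degree (allFin n))
      ≤⟨ sum-≤-support*bound partnered? degree maximal unpartnered (allFin n) ⟩
    length (filter partnered? (allFin n)) * degree u
      ≡⟨ cong₂ _*_ (∣tabulate∣≡length-filter partnered? id) (∣tabulate∣≡length-filter (paired? u) id) ⟨
    ∣ S₁ ∣ * ∣ S₂ ∣ ∎
    where
    open ≤-Reasoning

    across⊆ : mapMaybe across I ⊆ cartesianProduct (allFin n) (allFin m)
    across⊆ = subst (mapMaybe across I ⊆_) (mapMaybe-across-pairs (allFin n) (allFin m))
                    (mapMaybe⁺ across (proj₁ I-independent))

    maximal : ∀ a → degree a ≤ degree u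
    maximal a = All.lookup (f[xs]≤f[argmax] u₀ (allFin n)) (∈-allFin a)

    unpartnered : ∀ a → ¬ Any (Paired a) (allFin m) → degree a ≡ 0
    unpartnered a none = cong length (filter-none (paired? a) (¬Any⇒All¬ _ none))

lemma3 : (n m : ℕ) → 1 ≤ n → (H : SimpleGraph m) →
    (I : List (V (F₂ (join (Empty n) H)))) →
    IsIndependent (F₂ (join (Empty n) H)) I →
    Any Crossing I →
    Σ (Subset n) λ S₁ → Σ (Subset m) λ S₂ →
      IsIndependentSubset (Empty n) S₁ × IsIndependentSubset H S₂ ×
      (length I ≤ ∣ S₁ ∣ * ∣ S₂ ∣ + α (F₂ (delete (Empty n) S₁)) + α (F₂ (delete H S₂)))
lemma3 n m 1≤n H I I-independent _ = S₁ , S₂ , (λ _ _ _ _ → refl) , S₂-independent , (begin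
  length I
    ≡⟨ length-across+inside I ⟩
  length (mapMaybe across I) + length (mapMaybe inside₁ I) + length (mapMaybe inside₂ I)
    ≤⟨ +-mono-≤ (+-mono-≤ across-bound (length-inside₁≤α I-independent S₁ inside₁-avoids-S₁))
                (length-inside₂≤α I-independent S₂ inside₂-avoids-S₂) ⟩
  ∣ S₁ ∣ * ∣ S₂ ∣ + α (F₂ (delete (Empty n) S₁)) + α (F₂ (delete H S₂)) ∎)
  where
  open Witnesses I-independent (fromℕ< 1≤n)
  open ≤-Reasoning
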